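{- If $G$ is a disconnected cograph without isolated vertices having $k$ connected components, then $\chi_{td}(G)=\chi(G)+2(k-1)$.
   Context: All graphs are finite, simple and undirected. A cograph is a graph with no induced path on four vertices. $\chi(G)$ is the chromatic number. A total dominator coloring (TD-coloring) of an isolate-free graph $G$ is a proper vertex coloring such that every vertex is adjacent to all vertices of some color class; $\chi_{td}(G)$ is the minimum number of colors in a TD-coloring. -}

module Defs where

open import Data.Nat using (ℕ; _≤_)
open import Data.Fin using (Fin)
open import Data.Bool using (Bool; true; false)
open import Data.Product using (Σ; ∃; _×_; _,_)
open import Relation.Binary.PropositionalEquality using (_≡_; _≢_)
open import Relation.Nullary using (¬_)
open import Data.Empty using (⊥)
open import Function.Bundles using (_⇔_)
open import Relation.Binary.Construct.Closure.ReflexiveTransitive using (Star)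

record Graph (n : ℕ) : Set where
  field
    adj     : Fin n → Fin n → Bool
    adj-sym : ∀ u v → adj u v ≡ adj v u
    adj-irr : ∀ v → adj v v ≡ false

module _ {n : ℕ} (G : Graph n) where
  open Graph G

  Adj : Fin n → Fin n → Set
  Adj u v = adj u v ≡ true

  IsolateFree : Set
  IsolateFree = ∀ v → ∃ λ u → Adj v u

  -- no induced path a - b - c - d (distinctness of a,b,c,d follows
  -- from the (non-)adjacencies in a simple graph)
  Cograph : Set
  Cograph = ∀ a b c d → Adj a b → Adj b c → Adj c d →
            ¬ Adj a c → ¬ Adj b d → ¬ Adj a d → ⊥

  Connected : Fin n → Fin n → Set
  Connected = Star Adj

  HasComponents : ℕ → Set
  HasComponents k = Σ (Fin n → Fin k) λ comp →
      (∀ i → ∃ λ v → comp v ≡ i) ×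
      (∀ u v → (comp u ≡ comp v) ⇔ Connected u v)

  Proper : {m : ℕ} → (Fin n → Fin m) → Set
  Proper c = ∀ u v → Adj u v → c u ≢ c v

  TDColoring : {m : ℕ} → (Fin n → Fin m) → Set
  TDColoring {m} c = Proper c ×
      (∀ v → Σ (Fin m) λ i → (∃ λ w → c w ≡ i) × (∀ w → c w ≡ i → Adj v w))

  IsChromaticNumber : ℕ → Set
  IsChromaticNumber m =
    (Σ (Fin n → Fin m) Proper) ×
    (∀ j → (c : Fin n → Fin j) → Proper c → m ≤ j)

  IsTDChromaticNumber : ℕ → Set
  IsTDChromaticNumber m =
    (Σ (Fin n → Fin m) TDColoring) ×
    (∀ j → (c : Fin n → Fin j) → TDColoring c → m ≤ j)

-- By Seinsche's theorem every component of a cograph with at least two vertices is the join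
-- of two non-empty parts.  In a proper colouring, the colours x and y of one vertex from each
-- part are such that every vertex of the component is adjacent to all its vertices of colour x,
-- or to all of colour y.  Permuting colours per component so that these pairs coincide, and then
-- replacing the shared pair by a fresh pair in each component, gives a TD-colouring with
-- χ − 2 + 2k colours.  Conversely, in a TD-colouring each component owns two colour classes:
-- the class dominated by one of its vertices, and the class dominated by a vertex of that
-- class.  Merging the owned classes of all components into those of one component leaves a
-- proper colouring avoiding 2(k − 1) of the colours.

module Submission where

open import Defs
open import Data.Bool using (Bool; true; false; not; if_then_else_)
open import Data.Bool.Properties using (¬-not; not-¬; not-involutive; not-injective)
  renaming (_≟_ to _≟ᵇ_)
open import Data.Empty using (⊥; ⊥-elim)
open import Data.Fin using (Fin; zero; suc; punchOut)
open import Data.Fin.Properties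
  using (_≟_; ¬Fin0; suc-injective; punchOut-injective; injective⇒≤; +↔⊎; *↔×; 2↔Bool)
open import Data.Fin.Permutation.Components using (transpose; transpose-inverse)
open import Data.List using (List; []; _∷_; filter; allFin)
open import Data.List.Membership.Propositional using (_∈_; _∉_; find; lose)
open import Data.List.Membership.Propositional.Properties using (∈-filter⁺; ∈-filter⁻; ∈-allFin)
open import Data.List.Relation.Unary.Any using (here; there; any?)
open import Data.List.Relation.Unary.Unique.Propositional using (Unique; []; _∷_)
open import Data.List.Relation.Unary.Unique.Propositional.Properties
  using (allFin⁺; filter⁺; Unique[x∷xs]⇒x∉xs)
open import Data.Nat using (ℕ; zero; suc; _+_; _*_; _∸_; _≤_; z≤n; s≤s)
open import Data.Nat.Properties using (≤-antisym; m≤o∸n⇒m+n≤o)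
open import Data.Nat.Tactic.RingSolver using (solve-∀)
open import Data.Product using (Σ; ∃; _×_; _,_; proj₁; proj₂)
open import Data.Sum using (_⊎_; inj₁; inj₂; map₂; swap)
open import Data.Sum.Function.Propositional using (_⊎-↔_)
open import Data.Product.Function.NonDependent.Propositional using (_×-↔_)
open import Function using (_∘_; id; _⇔_; _↔_; Equivalence; Injective; Injection; Inverse)
open import Function.Properties.Inverse using (↔-refl; ↔-sym; ↔-trans; ↔⇒↣)
open import Relation.Binary.Definitions using (DecidableEquality)
open import Relation.Binary.PropositionalEquality
open import Relation.Binary.Construct.Closure.ReflexiveTransitive using (ε; _◅_)
open import Relation.Nullary using (yes; no; does; contradiction)
open import Relation.Nullary.Decidable using (dec-true; dec-false; decidable-stable; _×-dec_)

module _ {m : ℕ} where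

  transpose-matchˡ : (i j : Fin m) → transpose i j i ≡ j
  transpose-matchˡ i j rewrite dec-true (i ≟ i) refl = refl

  transpose-fixes : ∀ {i j k : Fin m} → k ≢ i → k ≢ j → transpose i j k ≡ k
  transpose-fixes {i} {j} {k} k≢i k≢j
    rewrite dec-false (k ≟ i) k≢i | dec-false (k ≟ j) k≢j = refl

  transpose-injective : (i j : Fin m) → Injective _≡_ _≡_ (transpose i j)
  transpose-injective i j {k} {l} eq = begin
    k                                ≡⟨ transpose-inverse j i ⟨
    transpose j i (transpose i j k)  ≡⟨ cong (transpose j i) eq ⟩
    transpose j i (transpose i j l)  ≡⟨ transpose-inverse j i ⟩
    l                                ∎
    where open ≡-Reasoning

  relabel : (x p : Bool → Fin m) → Fin m → Fin m
  relabel x p = transpose (transpose (x true) (p true) (x false)) (p false)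
              ∘ transpose (x true) (p true)

  relabel-injective : ∀ x p → Injective _≡_ _≡_ (relabel x p)
  relabel-injective x p =
    transpose-injective (x true) (p true)
    ∘ transpose-injective (transpose (x true) (p true) (x false)) (p false)

  relabel-pair : ∀ {x p} → x true ≢ x false → p true ≢ p false →
                 ∀ s → relabel x p (x s) ≡ p s
  relabel-pair {x} {p} x≢ p≢ true = begin
    transpose (τ (x false)) (p false) (τ (x true)) ≡⟨ cong (transpose _ _) (transpose-matchˡ (x true) (p true)) ⟩
    transpose (τ (x false)) (p false) (p true)     ≡⟨ transpose-fixes pt≢τxf p≢ ⟩
    p true                                         ∎
    where
    open ≡-Reasoning
    τ = transpose (x true) (p true)
    pt≢τxf : p true ≢ τ (x false)
    pt≢τxf e = x≢ (transpose-injective (x true) (p true) (trans (transpose-matchˡ (x true) (p true)) e))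
  relabel-pair {x} {p} _ _ false = transpose-matchˡ (transpose (x true) (p true) (x false)) (p false)

  relabel-fixes : ∀ {x p z} → (∀ s → z ≢ x s) → (∀ s → z ≢ p s) → relabel x p z ≡ z
  relabel-fixes {x} {p} {z} z≢x z≢p =
    trans (cong (transpose (τ (x false)) (p false)) τz≡z) (transpose-fixes z≢τxf (z≢p false))
    where
    τ = transpose (x true) (p true)
    τz≡z : τ z ≡ z
    τz≡z = transpose-fixes (z≢x true) (z≢p true)
    z≢τxf : z ≢ τ (x false)
    z≢τxf e = z≢x false (transpose-injective (x true) (p true) (trans τz≡z e))

squeeze : ∀ {A : Set} {j s} (f : Fin s → Fin j) → Injective _≡_ _≡_ f →
          (c : A → Fin j) → (∀ x t → c x ≢ f t) →
          Σ (A → Fin (j ∸ s)) λ c′ → ∀ {x y} → c′ x ≡ c′ y → c x ≡ c y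
squeeze {s = zero} f _ c _ = c , id
squeeze {j = zero} {suc s} f _ _ _ = ⊥-elim (¬Fin0 (f zero))
squeeze {j = suc j} {suc s} f f-inj c avoids =
  proj₁ squeezed , reflect ∘ proj₂ squeezed
  where
  f₀≢c : ∀ x → f zero ≢ c x
  f₀≢c x = avoids x zero ∘ sym
  f₀≢f : ∀ t → f zero ≢ f (suc t)
  f₀≢f t e = contradiction (f-inj e) λ ()
  c′ : _ → Fin j
  c′ x = punchOut (f₀≢c x)
  reflect : ∀ {x y} → c′ x ≡ c′ y → c x ≡ c y
  reflect {x} {y} = punchOut-injective (f₀≢c x) (f₀≢c y)
  f′ : Fin s → Fin j
  f′ t = punchOut (f₀≢f t)
  f′-injective : Injective _≡_ _≡_ f′
  f′-injective {t} {u} e = suc-injective (f-inj (punchOut-injective (f₀≢f t) (f₀≢f u) e))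
  squeezed = squeeze f′ f′-injective c′ λ x t e →
    avoids x (suc t) (punchOut-injective (f₀≢c x) (f₀≢f t) e)

module Decomposition {V : Set} (_≟ᵥ_ : DecidableEquality V) where

  complement : (V → V → Bool) → V → V → Bool
  complement r u v = not (r u v)

  Symmetricᵇ : (V → V → Bool) → Set
  Symmetricᵇ r = ∀ u v → r u v ≡ r v u

  P₄Free : (V → V → Bool) → Set
  P₄Free r = ∀ a b c d → r a b ≡ true → r b c ≡ true → r c d ≡ true →
             r a c ≡ false → r b d ≡ false → r a d ≡ false → ⊥

  complement-symmetric : ∀ {r} → Symmetricᵇ r → Symmetricᵇ (complement r)
  complement-symmetric r-sym u v = cong not (r-sym u v)

  -- The complement of the path a b c d is the path b d a c.
  complement-P₄Free : ∀ {r} → Symmetricᵇ r → P₄Free r → P₄Free (complement r)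
  complement-P₄Free {r} r-sym p₄-free a b c d ab bc cd ac bd ad =
    p₄-free b d a c (not-injective bd) (trans (r-sym d a) (not-injective ad)) (not-injective ac)
      (trans (r-sym b a) (not-injective ab)) (trans (r-sym d c) (not-injective cd)) (not-injective bc)

  record Separation (r : V → V → Bool) (P : V → Set) : Set where
    field
      side      : V → Bool
      inhabited : ∀ s → ∃ λ a → P a × side a ≡ s
      no-edge   : ∀ {a b} → P a → P b → side a ≢ side b → r a b ≡ false

  separation-⇔ : ∀ {r} {P Q : V → Set} → (∀ {x} → P x → Q x) → (∀ {x} → Q x → P x) →
                 Separation r P → Separation r Q
  separation-⇔ P⇒Q Q⇒P sep = record
    { side      = side
    ; inhabited = λ s → let (a , Pa , sa) = inhabited s in a , P⇒Q Pa , sa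
    ; no-edge   = λ Qa Qb → no-edge (Q⇒P Qa) (Q⇒P Qb)
    }
    where open Separation sep

  separation-complement² : ∀ {r P} → Separation (complement (complement r)) P → Separation r P
  separation-complement² {r} sep = record
    { side      = side
    ; inhabited = inhabited
    ; no-edge   = λ {a} {b} Pa Pb ne → trans (sym (not-involutive (r a b))) (no-edge Pa Pb ne)
    }
    where open Separation sep

  assign : (V → Bool) → V → Bool → V → Bool
  assign σ v s x = if does (x ≟ᵥ v) then s else σ x

  assign-here : ∀ σ {v s} → assign σ v s v ≡ s
  assign-here σ {v} {s} with v ≟ᵥ v
  ... | yes _  = refl
  ... | no v≢v = contradiction refl v≢v

  assign-elsewhere : ∀ σ {v s x} → x ≢ v → assign σ v s x ≡ σ x
  assign-elsewhere σ {v} {s} {x} x≢v with x ≟ᵥ v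
  ... | yes x≡v = contradiction x≡v x≢v
  ... | no _    = refl

  module Extension (r : V → V → Bool) (r-sym : Symmetricᵇ r)
                   {v : V} {S : List V} (v∉S : v ∉ S) where

    private
      ≢v : ∀ {x} → x ∈ S → x ≢ v
      ≢v x∈S refl = v∉S x∈S

    isolate : ∀ {u} → u ∈ S → (∀ {b} → b ∈ S → r v b ≡ false) → Separation r (_∈ v ∷ S)
    isolate {u} u∈S v-isolated = record
      { side = side ; inhabited = inhabited ; no-edge = no-edge }
      where
      side = assign (λ _ → false) v true
      inhabited : ∀ s → ∃ λ a → a ∈ v ∷ S × side a ≡ s
      inhabited true  = v , here refl , assign-here _
      inhabited false = u , there u∈S , assign-elsewhere _ (≢v u∈S)
      no-edge : ∀ {a b} → a ∈ v ∷ S → b ∈ v ∷ S → side a ≢ side b → r a b ≡ false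
      no-edge (here refl) (here refl) ne = contradiction refl ne
      no-edge (here refl) (there b∈S) _  = v-isolated b∈S
      no-edge (there a∈S) (here refl) _  = trans (r-sym _ v) (v-isolated a∈S)
      no-edge (there a∈S) (there b∈S) ne =
        contradiction (trans (assign-elsewhere _ (≢v a∈S)) (sym (assign-elsewhere _ (≢v b∈S)))) ne

    module _ (sep : Separation r (_∈ S)) where
      open Separation sep

      extend : (s : Bool) → (∀ {b} → b ∈ S → r v b ≡ true → side b ≡ s) →
               Separation r (_∈ v ∷ S)
      extend s neighbours-on-s = record
        { side = side′ ; inhabited = inhabited′ ; no-edge = no-edge′ }
        where
        side′ = assign side v s
        side′-v : side′ v ≡ s
        side′-v = assign-here side
        side′-S : ∀ {x} → x ∈ S → side′ x ≡ side x
        side′-S x∈S = assign-elsewhere side (≢v x∈S)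
        off-s : ∀ {b} → b ∈ S → side b ≢ s → r v b ≡ false
        off-s b∈S b≢s = ¬-not (b≢s ∘ neighbours-on-s b∈S)
        inhabited′ : ∀ t → ∃ λ a → a ∈ v ∷ S × side′ a ≡ t
        inhabited′ t with t ≟ᵇ s
        ... | yes refl = v , here refl , side′-v
        ... | no _     = let (a , a∈S , sa) = inhabited t in a , there a∈S , trans (side′-S a∈S) sa
        no-edge′ : ∀ {a b} → a ∈ v ∷ S → b ∈ v ∷ S → side′ a ≢ side′ b → r a b ≡ false
        no-edge′ (here refl) (here refl) ne = contradiction refl ne
        no-edge′ (here refl) (there b∈S) ne =
          off-s b∈S λ e → ne (trans side′-v (sym (trans (side′-S b∈S) e)))
        no-edge′ (there a∈S) (here refl) ne =
          trans (r-sym _ v) (off-s a∈S λ e → ne (trans (side′-S a∈S) (trans e (sym side′-v))))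
        no-edge′ (there a∈S) (there b∈S) ne =
          no-edge a∈S b∈S λ e → ne (trans (side′-S a∈S) (trans e (sym (side′-S b∈S))))

      -- If v has neighbours on both sides of sep, P₄-freeness leaves no edge between the
      -- neighbours and the non-neighbours of v.
      split-neighbourhood : P₄Free r →
        (∀ s → ∃ λ z → z ∈ S × side z ≡ s × r v z ≡ true) →
        ∀ {w} → w ∈ S → r v w ≡ false → Separation r (_∈ v ∷ S)
      split-neighbourhood p₄-free neighbour {w} w∈S vw = record
        { side = side′ ; inhabited = inhabited′ ; no-edge = no-edge′ }
        where
        side′ = assign (r v) v true
        side′-v : side′ v ≡ true
        side′-v = assign-here (r v)
        side′-S : ∀ {x} → x ∈ S → side′ x ≡ r v x
        side′-S x∈S = assign-elsewhere (r v) (≢v x∈S)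
        inhabited′ : ∀ t → ∃ λ a → a ∈ v ∷ S × side′ a ≡ t
        inhabited′ true  = v , here refl , side′-v
        inhabited′ false = w , there w∈S , trans (side′-S w∈S) vw
        across : ∀ {a b} → a ∈ S → b ∈ S → r v a ≡ true → r v b ≡ false → r a b ≡ false
        across {a} {b} a∈S b∈S va vb = ¬-not λ ab → case-sides ab (side a ≟ᵇ side b)
          where
          case-sides : r a b ≡ true → _ → ⊥
          case-sides ab (no a≢b) = contradiction (trans (sym ab) (no-edge a∈S b∈S a≢b)) λ ()
          case-sides ab (yes a≡b) =
            let (z , z∈S , sz , vz) = neighbour (not (side a))
                a≢z = λ e → not-¬ refl (trans e sz)
            in p₄-free b a v z (trans (r-sym b a) ab) (trans (r-sym a v) va) vz (trans (r-sym b v) vb)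
                 (no-edge a∈S z∈S a≢z) (no-edge b∈S z∈S (a≢z ∘ trans a≡b))
        no-edge′ : ∀ {a b} → a ∈ v ∷ S → b ∈ v ∷ S → side′ a ≢ side′ b → r a b ≡ false
        no-edge′ (here refl) (here refl) ne = contradiction refl ne
        no-edge′ (here refl) (there b∈S) ne =
          ¬-not λ e → ne (trans side′-v (sym (trans (side′-S b∈S) e)))
        no-edge′ (there a∈S) (here refl) ne =
          trans (r-sym _ v) (¬-not λ e → ne (trans (side′-S a∈S) (trans e (sym side′-v))))
        no-edge′ (there a∈S) (there b∈S) ne =
          separated a∈S b∈S λ e → ne (trans (side′-S a∈S) (trans e (sym (side′-S b∈S))))
          where
          separated : ∀ {a b} → a ∈ S → b ∈ S → r v a ≢ r v b → r a b ≡ false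
          separated {a} {b} a∈S b∈S ne with r v a in va | r v b in vb
          ... | true  | false = across a∈S b∈S va vb
          ... | false | true  = trans (r-sym a b) (across b∈S a∈S vb va)
          ... | true  | true  = contradiction refl ne
          ... | false | false = contradiction refl ne

  extend-separation : ∀ {r} → Symmetricᵇ r → P₄Free r → ∀ {v S} → v ∉ S →
                      Separation r (_∈ S) →
                      Separation r (_∈ v ∷ S) ⊎ Separation (complement r) (_∈ v ∷ S)
  extend-separation {r} r-sym p₄-free {v} {S} v∉S sep with any? (λ b → r v b ≟ᵇ false) S
  ... | no adjacent-to-all =
    let (u , u∈S , _) = inhabited true
    in inj₂ (Extension.isolate (complement r) (complement-symmetric r-sym) v∉S u∈S
               λ b∈S → cong not (¬-not (adjacent-to-all ∘ lose b∈S)))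
    where open Separation sep
  ... | yes non-neighbour
    with find non-neighbour
       | any? (λ z → (side z ≟ᵇ true) ×-dec (r v z ≟ᵇ true)) S
       | any? (λ z → (side z ≟ᵇ false) ×-dec (r v z ≟ᵇ true)) S
    where open Separation sep
  ... | _ | no none-true | _ =
    inj₁ (extend sep false λ b∈S vb → ¬-not λ sb → none-true (lose b∈S (sb , vb)))
    where open Extension r r-sym v∉S
  ... | _ | yes _ | no none-false =
    inj₁ (extend sep true λ b∈S vb → ¬-not λ sb → none-false (lose b∈S (sb , vb)))
    where open Extension r r-sym v∉S
  ... | (w , w∈S , vw) | yes some-true | yes some-false =
    inj₁ (split-neighbourhood sep p₄-free neighbour w∈S vw)
    where
    open Extension r r-sym v∉S
    neighbour : ∀ s → ∃ λ z → z ∈ S × Separation.side sep z ≡ s × r v z ≡ true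
    neighbour true  = find some-true
    neighbour false = find some-false

  Subsingleton : List V → Set
  Subsingleton S = ∀ {a b} → a ∈ S → b ∈ S → a ≡ b

  extend-subsingleton : ∀ {r} → Symmetricᵇ r → ∀ {v S} → v ∉ S → Subsingleton S →
    Subsingleton (v ∷ S) ⊎ Separation r (_∈ v ∷ S) ⊎ Separation (complement r) (_∈ v ∷ S)
  extend-subsingleton r-sym {S = []} _ _ = inj₁ λ { (here refl) (here refl) → refl }
  extend-subsingleton {r} r-sym {v} {u ∷ S} v∉S single with r v u in vu
  ... | false = inj₂ (inj₁ (Extension.isolate r r-sym v∉S (here refl) λ b∈S →
                  trans (cong (r v) (single b∈S (here refl))) vu))
  ... | true  = inj₂ (inj₂ (Extension.isolate (complement r) (complement-symmetric r-sym) v∉S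
                  (here refl) λ b∈S → cong not (trans (cong (r v) (single b∈S (here refl))) vu)))

  decompose : ∀ {r} → Symmetricᵇ r → P₄Free r → ∀ {S} → Unique S →
    Subsingleton S ⊎ Separation r (_∈ S) ⊎ Separation (complement r) (_∈ S)
  decompose r-sym p₄-free [] = inj₁ λ ()
  decompose {r} r-sym p₄-free unique@(_ ∷ unique-S) with decompose r-sym p₄-free unique-S
  ... | inj₁ single     = extend-subsingleton r-sym (Unique[x∷xs]⇒x∉xs unique) single
  ... | inj₂ (inj₁ sep) = inj₂ (extend-separation r-sym p₄-free (Unique[x∷xs]⇒x∉xs unique) sep)
  ... | inj₂ (inj₂ sep) =
    inj₂ (swap (map₂ separation-complement²
      (extend-separation (complement-symmetric r-sym) (complement-P₄Free r-sym p₄-free)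
        (Unique[x∷xs]⇒x∉xs unique) sep)))

module Components {n k : ℕ} (G : Graph n) (comp : Fin n → Fin k)
                  (comp-surjective : ∀ i → ∃ λ v → comp v ≡ i)
                  (comp-≡⇔ : ∀ u v → (comp u ≡ comp v) ⇔ Connected G u v) where

  open Graph G
  open Decomposition (_≟_ {n})

  adjacent⇒same-component : ∀ {u v} → Adj G u v → comp u ≡ comp v
  adjacent⇒same-component uv = Equivalence.from (comp-≡⇔ _ _) (uv ◅ ε)

  proper-componentwise : ∀ {m m′} (ρ : Fin k → Fin m → Fin m′) →
                         (∀ i → Injective _≡_ _≡_ (ρ i)) →
                         ∀ {c} → Proper G c → Proper G (λ v → ρ (comp v) (c v))
  proper-componentwise ρ ρ-injective {c} proper u v uv eq =
    proper u v uv (ρ-injective (comp v)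
      (subst (λ i → ρ i (c u) ≡ ρ (comp v) (c v)) (adjacent⇒same-component uv) eq))

  component-not-separated : ∀ {i} → Separation adj (λ v → comp v ≡ i) → ⊥
  component-not-separated {i} sep =
    let (a , ai , sa) = inhabited true
        (b , bi , sb) = inhabited false
        path = Equivalence.to (comp-≡⇔ a b) (trans ai (sym bi))
    in contradiction (trans (sym sa) (trans (side-constant ai path) sb)) λ ()
    where
    open Separation sep
    side-constant : ∀ {x y} → comp x ≡ i → Connected G x y → side x ≡ side y
    side-constant _  ε = refl
    side-constant xi (xz ◅ path) =
      trans (decidable-stable (_ ≟ᵇ _) λ x≢z → contradiction (trans (sym xz) (no-edge xi zi x≢z)) λ ())
            (side-constant zi path)
      where zi = trans (sym (adjacent⇒same-component xz)) xi

  cograph⇒P₄Free : Cograph G → P₄Free adj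
  cograph⇒P₄Free cograph a b c d ab bc cd ac bd ad =
    cograph a b c d ab bc cd (not-¬ ac) (not-¬ bd) (not-¬ ad)

  ∈-component⁺ : ∀ {v i} → comp v ≡ i → v ∈ filter (λ v → comp v ≟ i) (allFin n)
  ∈-component⁺ {v} vi = ∈-filter⁺ _ (∈-allFin v) vi

  ∈-component⁻ : ∀ {v i} → v ∈ filter (λ v → comp v ≟ i) (allFin n) → comp v ≡ i
  ∈-component⁻ {v} {i} = proj₂ ∘ ∈-filter⁻ (λ v → comp v ≟ i) {xs = allFin n}

  component-join : Cograph G → IsolateFree G → ∀ i → Separation (complement adj) (λ v → comp v ≡ i)
  component-join cograph isolate-free i
    with decompose adj-sym (cograph⇒P₄Free cograph) (filter⁺ (λ v → comp v ≟ i) (allFin⁺ n))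
  ... | inj₁ single =
    let (u , ui) = comp-surjective i
        (w , uw) = isolate-free u
        wi = trans (sym (adjacent⇒same-component uw)) ui
        u≡w = single (∈-component⁺ ui) (∈-component⁺ wi)
    in contradiction (subst (λ x → adj x w ≡ true) u≡w uw) (not-¬ (adj-irr w))
  ... | inj₂ (inj₁ sep) = ⊥-elim (component-not-separated (separation-⇔ ∈-component⁻ ∈-component⁺ sep))
  ... | inj₂ (inj₂ sep) = separation-⇔ ∈-component⁻ ∈-component⁺ sep

  record DominatingPair {m} (c : Fin n → Fin m) (i : Fin k) : Set where
    field
      colour    : Bool → Fin m
      distinct  : colour true ≢ colour false
      used      : ∀ s → ∃ λ w → comp w ≡ i × c w ≡ colour s
      dominated : ∀ {v} → comp v ≡ i →
                  ∃ λ s → ∀ {w} → comp w ≡ i → c w ≡ colour s → Adj G v w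

  dominating-pair : Cograph G → IsolateFree G → ∀ {m} {c : Fin n → Fin m} → Proper G c →
                    ∀ i → DominatingPair c i
  dominating-pair cograph isolate-free {c = c} proper i = record
    { colour    = colour
    ; distinct  = proper (witness true) (witness false)
                    (complete (witness-in true) (witness-in false) witness-sides)
    ; used      = λ s → witness s , witness-in s , refl
    ; dominated = λ {v} vi → not (side v) , λ wi cw →
                    complete vi wi λ e → not-¬ refl (trans e (on-side wi cw))
    }
    where
    open Separation (component-join cograph isolate-free i)
    witness : Bool → Fin n
    witness s = proj₁ (inhabited s)
    witness-in : ∀ s → comp (witness s) ≡ i
    witness-in s = proj₁ (proj₂ (inhabited s))
    witness-side : ∀ s → side (witness s) ≡ s
    witness-side s = proj₂ (proj₂ (inhabited s))
    witness-sides : side (witness true) ≢ side (witness false)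
    witness-sides e = contradiction (trans (sym (witness-side true)) (trans e (witness-side false))) λ ()
    colour : Bool → Fin _
    colour s = c (witness s)
    complete : ∀ {a b} → comp a ≡ i → comp b ≡ i → side a ≢ side b → Adj G a b
    complete ai bi a≢b = not-injective (no-edge ai bi a≢b)
    -- a vertex of colour s off side s would be adjacent to the witness of side s
    on-side : ∀ {w s} → comp w ≡ i → c w ≡ colour s → side w ≡ s
    on-side {w} {s} wi cw = decidable-stable (side w ≟ᵇ s) λ w≢s →
      proper w (witness s) (complete wi (witness-in s) λ e → w≢s (trans e (witness-side s))) cw

  td-colouring : Cograph G → IsolateFree G → ∀ {χ′} {c : Fin n → Fin (2 + χ′)} → Proper G c →
                 Σ (Fin n → Fin (k + k + χ′)) (TDColoring G)
  td-colouring cograph isolate-free {χ′} {c} proper =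
    colouring , proper-componentwise recolour recolour-injective proper , dominates
    where
    pair : ∀ i → DominatingPair c i
    pair = dominating-pair cograph isolate-free proper
    open DominatingPair using (used; dominated)
    colour : Fin k → Bool → Fin (2 + χ′)
    colour i = DominatingPair.colour (pair i)

    special : Bool → Fin (2 + χ′)
    special true  = zero
    special false = suc zero

    π : Fin k → Fin (2 + χ′) → Fin (2 + χ′)
    π i = relabel (colour i) special

    π-pair : ∀ i s → π i (colour i s) ≡ special s
    π-pair i = relabel-pair {x = colour i} {p = special} (DominatingPair.distinct (pair i)) λ ()

    Class : Set
    Class = (Fin k ⊎ Fin k) ⊎ Fin χ′

    class-of : Fin k → Fin (2 + χ′) → Class
    class-of i zero          = inj₁ (inj₁ i)
    class-of i (suc zero)    = inj₁ (inj₂ i)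
    class-of i (suc (suc a)) = inj₂ a

    unclass : Class → Fin (2 + χ′)
    unclass (inj₁ (inj₁ _)) = zero
    unclass (inj₁ (inj₂ _)) = suc zero
    unclass (inj₂ a)        = suc (suc a)

    unclass-class-of : ∀ i a → unclass (class-of i a) ≡ a
    unclass-class-of i zero          = refl
    unclass-class-of i (suc zero)    = refl
    unclass-class-of i (suc (suc a)) = refl

    class-of-injective : ∀ i → Injective _≡_ _≡_ (class-of i)
    class-of-injective i {a} {b} e =
      trans (sym (unclass-class-of i a)) (trans (cong unclass e) (unclass-class-of i b))

    class-of-special : ∀ {i i′ a} s → class-of i′ a ≡ class-of i (special s) →
                       i′ ≡ i × a ≡ special s
    class-of-special {a = zero}          true  refl = refl , refl
    class-of-special {a = suc zero}      false refl = refl , refl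
    class-of-special {a = zero}          false ()
    class-of-special {a = suc zero}      true  ()
    class-of-special {a = suc (suc _)}   true  ()
    class-of-special {a = suc (suc _)}   false ()

    code : Class ↔ Fin (k + k + χ′)
    code = ↔-sym (↔-trans +↔⊎ (+↔⊎ ⊎-↔ ↔-refl))

    code-injective : Injective _≡_ _≡_ (Inverse.to code)
    code-injective = Injection.injective (↔⇒↣ code)

    recolour : Fin k → Fin (2 + χ′) → Fin (k + k + χ′)
    recolour i = Inverse.to code ∘ class-of i ∘ π i

    recolour-injective : ∀ i → Injective _≡_ _≡_ (recolour i)
    recolour-injective i = relabel-injective (colour i) special ∘ class-of-injective i ∘ code-injective

    recolour-pair : ∀ {i i′ a} s → recolour i′ a ≡ recolour i (colour i s) →
                    i′ ≡ i × a ≡ colour i s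
    recolour-pair {i} {i′} {a} s e
      with class-of-special {i′ = i′} {a = π i′ a} s
             (trans (code-injective e) (cong (class-of i) (π-pair i s)))
    ... | refl , πa = refl , relabel-injective (colour i) special (trans πa (sym (π-pair i s)))

    colouring : Fin n → Fin (k + k + χ′)
    colouring v = recolour (comp v) (c v)

    dominates : ∀ v → Σ (Fin (k + k + χ′)) λ x →
                (∃ λ w → colouring w ≡ x) × (∀ w → colouring w ≡ x → Adj G v w)
    dominates v =
      let (s , dom)       = dominated (pair (comp v)) refl
          (w₀ , w₀i , cw₀) = used (pair (comp v)) s
      in colouring w₀ , (w₀ , refl) , λ w e →
           let (wi , cw) = recolour-pair s (trans e (cong₂ recolour w₀i cw₀)) in dom wi cw

  record PrivateColours {j} (c : Fin n → Fin j) : Set where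
    field
      colour   : Bool → Fin k → Fin j
      used     : ∀ s i → ∃ λ w → c w ≡ colour s i
      confined : ∀ s i {w} → c w ≡ colour s i → comp w ≡ i
      distinct : ∀ i → colour true i ≢ colour false i

    colour-injective : ∀ s i s′ i′ → colour s i ≡ colour s′ i′ → s ≡ s′ × i ≡ i′
    colour-injective s i s′ i′ e with trans (sym (confined s i cw)) (confined s′ i′ (trans cw e))
      where cw = proj₂ (used s i)
    colour-injective true  i true  .i _ | refl = refl , refl
    colour-injective false i false .i _ | refl = refl , refl
    colour-injective true  i false .i e | refl = contradiction e (distinct i)
    colour-injective false i true  .i e | refl = contradiction (sym e) (distinct i)

  -- The two owned classes differ because no vertex is adjacent to itself.
  private-colours : ∀ {j} {c : Fin n → Fin j} → TDColoring G c → PrivateColours c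
  private-colours {c = c} (_ , td) = record
    { colour   = colour
    ; used     = λ s i → used-by (anchor s i)
    ; confined = λ s i cw → trans (dominated-confined cw) (anchor-in s i)
    ; distinct = λ i e → contradiction (dominated-adjacent (trans (proj₂ (used-by (anchor true i))) e))
                                         (not-¬ (adj-irr _))
    }
    where
    dominated : Fin n → Fin _
    dominated v = proj₁ (td v)
    used-by : ∀ v → ∃ λ w → c w ≡ dominated v
    used-by v = proj₁ (proj₂ (td v))
    dominated-adjacent : ∀ {v w} → c w ≡ dominated v → Adj G v w
    dominated-adjacent = proj₂ (proj₂ (td _)) _
    dominated-confined : ∀ {v w} → c w ≡ dominated v → comp w ≡ comp v
    dominated-confined = sym ∘ adjacent⇒same-component ∘ dominated-adjacent
    anchor : Bool → Fin k → Fin n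
    anchor true  i = proj₁ (comp-surjective i)
    anchor false i = proj₁ (used-by (anchor true i))
    anchor-in : ∀ s i → comp (anchor s i) ≡ i
    anchor-in true  i = proj₂ (comp-surjective i)
    anchor-in false i = trans (dominated-confined (proj₂ (used-by (anchor true i)))) (anchor-in true i)
    colour : Bool → Fin k → Fin _
    colour s i = dominated (anchor s i)

≢⇒2≤ : ∀ {m} {x y : Fin m} → x ≢ y → 2 ≤ m
≢⇒2≤ {suc zero}    {zero} {zero} x≢y = contradiction refl x≢y
≢⇒2≤ {suc (suc _)} _ = s≤s (s≤s z≤n)

colour-count : ∀ k′ χ′ → suc k′ + suc k′ + χ′ ≡ 2 + χ′ + 2 * k′
colour-count = solve-∀

module Bounds {n k′ : ℕ} (G : Graph n) (comp : Fin n → Fin (suc k′))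
              (comp-surjective : ∀ i → ∃ λ v → comp v ≡ i)
              (comp-≡⇔ : ∀ u v → (comp u ≡ comp v) ⇔ Connected G u v) where

  open Components G comp comp-surjective comp-≡⇔

  td-upper : Cograph G → IsolateFree G → ∀ {χ} {c : Fin n → Fin χ} → Proper G c →
             Σ (Fin n → Fin (χ + 2 * k′)) (TDColoring G)
  td-upper cograph isolate-free proper = by-size (≢⇒2≤ (proper u w uw)) proper
    where
    u = proj₁ (comp-surjective zero)
    w = proj₁ (isolate-free u)
    uw = proj₂ (isolate-free u)
    by-size : ∀ {χ} {c : Fin n → Fin χ} → 2 ≤ χ → Proper G c →
              Σ (Fin n → Fin (χ + 2 * k′)) (TDColoring G)
    by-size {suc (suc χ′)} (s≤s (s≤s _)) proper =
      subst (λ m → Σ (Fin n → Fin m) (TDColoring G)) (colour-count k′ χ′)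
            (td-colouring cograph isolate-free proper)

  td-lower : ∀ {j} {c : Fin n → Fin j} → TDColoring G c →
             ∀ {χ} → (∀ m (c : Fin n → Fin m) → Proper G c → χ ≤ m) → χ + 2 * k′ ≤ j
  td-lower {j} {c} td {χ} χ-minimal =
    m≤o∸n⇒m+n≤o χ (injective⇒≤ freed-injective)
      (χ-minimal _ (proj₁ squeezed) λ u v uv e → merged-proper u v uv (proj₂ squeezed e))
    where
    open PrivateColours (private-colours td)
    owned-by : Fin (suc k′) → Bool → Fin j
    owned-by i s = colour s i

    π : Fin (suc k′) → Fin j → Fin j
    π i = relabel (owned-by i) (owned-by zero)

    merged : Fin n → Fin j
    merged v = π (comp v) (c v)

    merged-proper : Proper G merged
    merged-proper =
      proper-componentwise π (λ i → relabel-injective (owned-by i) (owned-by zero)) (proj₁ td)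

    owned? : ∀ v → (∃ λ s → c v ≡ colour s (comp v)) ⊎ (∀ s i → c v ≢ colour s i)
    owned? v with c v ≟ colour true (comp v) | c v ≟ colour false (comp v)
    ... | yes e | _     = inj₁ (true , e)
    ... | no _  | yes e = inj₁ (false , e)
    ... | no ¬t | no ¬f = inj₂ λ
      { true  i e → ¬t (trans e (cong (colour true) (sym (confined true i e))))
      ; false i e → ¬f (trans e (cong (colour false) (sym (confined false i e))))
      }

    π-owned : ∀ i s → π i (colour s i) ≡ colour s zero
    π-owned i = relabel-pair {x = owned-by i} {p = owned-by zero} (distinct i) (distinct zero)

    π-unowned : ∀ {i a} → (∀ s i → a ≢ colour s i) → π i a ≡ a
    π-unowned {i} unowned =
      relabel-fixes {x = owned-by i} {p = owned-by zero} (λ s → unowned s i) (λ s → unowned s zero)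

    freed-pair : Bool × Fin k′ → Fin j
    freed-pair (s , t) = colour s (suc t)

    freed-pair-injective : Injective _≡_ _≡_ freed-pair
    freed-pair-injective {s , t} {s′ , t′} e with colour-injective s (suc t) s′ (suc t′) e
    ... | refl , refl = refl

    merged-avoids : ∀ v p → merged v ≢ freed-pair p
    merged-avoids v (s , t) e with owned? v
    ... | inj₁ (s′ , cv) =
      let e′ = trans (sym (π-owned (comp v) s′)) (trans (cong (π (comp v)) (sym cv)) e)
      in contradiction (proj₂ (colour-injective s′ zero s (suc t) e′)) λ ()
    ... | inj₂ unowned = unowned s (suc t) (trans (sym (π-unowned unowned)) e)

    index : Fin (2 * k′) ↔ (Bool × Fin k′)
    index = ↔-trans *↔× (2↔Bool ×-↔ ↔-refl)

    freed : Fin (2 * k′) → Fin j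
    freed = freed-pair ∘ Inverse.to index

    freed-injective : Injective _≡_ _≡_ freed
    freed-injective = Injection.injective (↔⇒↣ index) ∘ freed-pair-injective

    squeezed = squeeze freed freed-injective merged λ v → merged-avoids v ∘ Inverse.to index

theorem6 : ∀ {n : ℕ} (G : Graph n) (k χ χtd : ℕ) →
    Cograph G → IsolateFree G → HasComponents G k → 2 ≤ k →
    IsChromaticNumber G χ → IsTDChromaticNumber G χtd →
    χtd ≡ χ + 2 * (k ∸ 1)
theorem6 G (suc (suc k″)) χ χtd cograph isolate-free (comp , comp-surjective , comp-≡⇔)
         (s≤s (s≤s _)) ((_ , proper) , χ-minimal) ((_ , td) , td-minimal) =
  ≤-antisym (td-minimal _ (proj₁ upper) (proj₂ upper)) (td-lower td χ-minimal)
  where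
  open Bounds G comp comp-surjective comp-≡⇔
  upper = td-upper cograph isolate-free proper
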